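{- Let $h\geq0$ be an integer. (i) If $3\nmid h$, then $|\Lambda_{3,1}^{(h)}|=|\Lambda_{3,2}^{(h)}|=|\Lambda_{3,3}^{(h)}|$. (ii) If $3\mid h$, then $|\Lambda_{3,1}^{(h)}|=|\Lambda_{3,2}^{(h)}|=|\Lambda_{3,3}^{(h)}|-1$.
   Context: $\Lambda_3=\mathbb{Z}_{\geq0}^3$. For $k\in\{1,2,3\}$ and $h\geq0$, $\Lambda_{3,k}^{(h)}$ is the set of $(v_1,v_2,v_3)\in\mathbb{Z}_{\geq0}^3$ with $v_1+v_2+v_3=h$ and $3\mid v_1+2v_2+3v_3-k$. -}

module Defs where

open import Data.Nat using (ℕ; _+_; _*_; _∸_)
open import Data.Integer as ℤ using (ℤ; +_)
open import Data.Integer.Divisibility as ℤD using ()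
open import Data.Nat.Divisibility as ℕD using ()
open import Data.List using (List; []; _∷_; map; concatMap; upTo; filter; length)
open import Data.Product using (_×_; _,_)
open import Relation.Nullary using (Dec)

Triple : Set
Triple = ℕ × ℕ × ℕ

-- All triples (v₁,v₂,v₃) ∈ ℤ≥0³ with v₁+v₂+v₃ = h, each listed exactly once:
-- v₁ ranges over 0..h, v₂ over 0..h∸v₁, and v₃ = h ∸ v₁ ∸ v₂.
level : ℕ → List Triple
level h = concatMap (λ v₁ → map (λ v₂ → (v₁ , v₂ , h ∸ v₁ ∸ v₂)) (upTo (suc (h ∸ v₁)))) (upTo (suc h))
  where open Data.Nat using (suc)

Cond : ℕ → Triple → Set
Cond k (v₁ , v₂ , v₃) = (+ 3) ℤD.∣ ((+ (v₁ + 2 * v₂ + 3 * v₃)) ℤ.- (+ k))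

Cond? : ∀ k (t : Triple) → Dec (Cond k t)
Cond? k (v₁ , v₂ , v₃) = 3 ℕD.∣? ℤ.∣ (+ (v₁ + 2 * v₂ + 3 * v₃)) ℤ.- (+ k) ∣

Λ : ℕ → ℕ → List Triple
Λ k h = filter (Cond? k) (level h)

card : ℕ → ℕ → ℕ
card k h = length (Λ k h)

-- Modulo 3 the condition on (v₁, v₂, v₃) ∈ Λ_{3,k}^{(h)} reads 3 ∣ 2k + v₁ + 2v₂ (the term 3v₃
-- drops out). Grouping by v₁, the count is a triangle of row counts #{j < m : 3 ∣ c + 2j}; since
-- c, c + 2, c + 4 run through all residues, lengthening a row by 3 adds exactly one. Hence
-- |Λ_{3,k}^{(h+3)}| = |Λ_{3,k}^{(h)}| + h + 3 for every k, so the differences between the three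
-- counts depend only on h mod 3 and are read off at h = 0, 1, 2.

module Submission where

open import Defs
open import Data.Nat using (ℕ; zero; suc; _+_; _*_; _∸_)
open import Data.Nat.Properties using (+-identityʳ; +-suc)
open import Data.Nat.Divisibility as ℕ∣ using (_∣_)
import Data.Integer as ℤ
import Data.Integer.Properties as ℤₚ
import Data.Integer.Divisibility as ℤᵘ∣
import Data.Integer.Divisibility.Signed as ℤ∣
open import Data.List using (List; _++_; map; concatMap; applyUpTo; upTo; filter; length)
open import Data.List.Properties using (filter-++; length-++)
open import Data.Product using (_×_; _,_)
open import Data.Empty using (⊥-elim)
open import Function using (_∘_; id)
open import Function.Bundles using (_⇔_; mk⇔; Equivalence)
open import Relation.Nullary using (¬_; Dec; yes; no)
open import Relation.Nullary.Decidable using (toWitnessFalse)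
open import Relation.Unary using (Decidable)
open import Relation.Binary.PropositionalEquality
import Data.Nat.Tactic.RingSolver as ℕ-Solver
import Data.Integer.Tactic.RingSolver as ℤ-Solver

𝟙 : ∀ {a} {A : Set a} → Dec A → ℕ
𝟙 (yes _) = 1
𝟙 (no _) = 0

𝟙-cong : ∀ {a b} {A : Set a} {B : Set b} {a? : Dec A} {b? : Dec B} → A ⇔ B → 𝟙 a? ≡ 𝟙 b?
𝟙-cong {a? = yes a} {yes b} A⇔B = refl
𝟙-cong {a? = yes a} {no ¬b} A⇔B = ⊥-elim (¬b (Equivalence.to A⇔B a))
𝟙-cong {a? = no ¬a} {yes b} A⇔B = ⊥-elim (¬a (Equivalence.from A⇔B b))
𝟙-cong {a? = no ¬a} {no ¬b} A⇔B = refl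

∑ : ℕ → (ℕ → ℕ) → ℕ
∑ zero f = 0
∑ (suc n) f = f 0 + ∑ n (f ∘ suc)

∑-cong : ∀ n {f g : ℕ → ℕ} → (∀ i → f i ≡ g i) → ∑ n f ≡ ∑ n g
∑-cong zero f≗g = refl
∑-cong (suc n) f≗g = cong₂ _+_ (f≗g 0) (∑-cong n (f≗g ∘ suc))

module _ {a p} {A : Set a} {P : A → Set p} (P? : Decidable P) where

  length-filter-map-applyUpTo : ∀ (g : ℕ → A) (f : ℕ → ℕ) n →
    length (filter P? (map g (applyUpTo f n))) ≡ ∑ n (λ i → 𝟙 (P? (g (f i))))
  length-filter-map-applyUpTo g f zero = refl
  length-filter-map-applyUpTo g f (suc n) with P? (g (f 0))
  ... | yes _ = cong suc (length-filter-map-applyUpTo g (f ∘ suc) n)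
  ... | no _ = length-filter-map-applyUpTo g (f ∘ suc) n

  length-filter-concatMap-applyUpTo : ∀ (g : ℕ → List A) (f : ℕ → ℕ) n →
    length (filter P? (concatMap g (applyUpTo f n))) ≡ ∑ n (λ i → length (filter P? (g (f i))))
  length-filter-concatMap-applyUpTo g f zero = refl
  length-filter-concatMap-applyUpTo g f (suc n) = begin
    length (filter P? (g (f 0) ++ concatMap g (applyUpTo (f ∘ suc) n)))
      ≡⟨ cong length (filter-++ P? (g (f 0)) _) ⟩
    length (filter P? (g (f 0)) ++ filter P? (concatMap g (applyUpTo (f ∘ suc) n)))
      ≡⟨ length-++ (filter P? (g (f 0))) ⟩
    length (filter P? (g (f 0))) + length (filter P? (concatMap g (applyUpTo (f ∘ suc) n)))
      ≡⟨ cong (length (filter P? (g (f 0))) +_) (length-filter-concatMap-applyUpTo g (f ∘ suc) n) ⟩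
    length (filter P? (g (f 0))) + ∑ n (λ i → length (filter P? (g (f (suc i)))))
      ∎
    where open ≡-Reasoning

∣m+n⇔∣n : ∀ {d m n} → d ∣ m → d ∣ m + n ⇔ d ∣ n
∣m+n⇔∣n d∣m = mk⇔ (λ d∣m+n → ℕ∣.∣m+n∣m⇒∣n d∣m+n d∣m) (ℕ∣.∣m∣n⇒∣m+n d∣m)

module _ where
  open ℤ using (+_)

  ∣ℤm⇔∣ℤm+n : ∀ {i m n} → i ℤ∣.∣ n → i ℤ∣.∣ m ⇔ i ℤ∣.∣ m ℤ.+ n
  ∣ℤm⇔∣ℤm+n i∣n = mk⇔ (λ i∣m → ℤ∣.∣m∣n⇒∣m+n i∣m i∣n) (λ i∣m+n → ℤ∣.∣m+n∣n⇒∣m i∣m+n i∣n)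

  -- n ≡ k (mod d + 1) moves to ℕ as (d + 1) ∣ n + d k, because n + d k = (n - k) + (d + 1) k.
  ∣[n-k]⇔∣n+d*k : ∀ d n k → + suc d ℤᵘ∣.∣ + n ℤ.- + k ⇔ suc d ∣ n + d * k
  ∣[n-k]⇔∣n+d*k d n k = mk⇔ to from
    where
    n+d*k≡[n-k]+[1+d]k : + (n + d * k) ≡ (+ n ℤ.- + k) ℤ.+ + (suc d * k)
    n+d*k≡[n-k]+[1+d]k = begin
      + (n + d * k)                                ≡⟨ ℤₚ.pos-+ n (d * k) ⟩
      + n ℤ.+ + (d * k)                            ≡⟨ rearrange (+ n) (+ k) (+ (d * k)) ⟩
      (+ n ℤ.- + k) ℤ.+ (+ k ℤ.+ + (d * k))        ≡⟨ cong (λ w → (+ n ℤ.- + k) ℤ.+ w) (sym (ℤₚ.pos-+ k (d * k))) ⟩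
      (+ n ℤ.- + k) ℤ.+ + (suc d * k)              ∎
      where
      open ≡-Reasoning
      rearrange : ∀ x y z → x ℤ.+ z ≡ (x ℤ.- y) ℤ.+ (y ℤ.+ z)
      rearrange = ℤ-Solver.solve-∀
    [1+d]∣[1+d]k : + suc d ℤ∣.∣ + (suc d * k)
    [1+d]∣[1+d]k = ℤ∣.∣ᵤ⇒∣ (ℕ∣.m∣m*n k)
    to : + suc d ℤᵘ∣.∣ + n ℤ.- + k → suc d ∣ n + d * k
    to d∣n-k = ℤ∣.∣⇒∣ᵤ (subst (+ suc d ℤ∣.∣_) (sym n+d*k≡[n-k]+[1+d]k)
      (Equivalence.to (∣ℤm⇔∣ℤm+n [1+d]∣[1+d]k) (ℤ∣.∣ᵤ⇒∣ {i = + n ℤ.- + k} d∣n-k)))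
    from : suc d ∣ n + d * k → + suc d ℤᵘ∣.∣ + n ℤ.- + k
    from d∣n+dk = ℤ∣.∣⇒∣ᵤ {i = + n ℤ.- + k} (Equivalence.from (∣ℤm⇔∣ℤm+n [1+d]∣[1+d]k)
      (subst (+ suc d ℤ∣.∣_) n+d*k≡[n-k]+[1+d]k (ℤ∣.∣ᵤ⇒∣ d∣n+dk)))

χ₃ : ℕ → ℕ
χ₃ n = 𝟙 (3 ℕ∣.∣? n)

χ₃-periodic : ∀ q a → χ₃ (3 * q + a) ≡ χ₃ a
χ₃-periodic q a = 𝟙-cong (∣m+n⇔∣n (ℕ∣.m∣m*n q))

row : ℕ → ℕ → ℕ
row c zero = 0
row c (suc m) = χ₃ c + row (2 + c) m

∑-row : ∀ c m → ∑ m (λ j → χ₃ (c + 2 * j)) ≡ row c m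
∑-row c zero = refl
∑-row c (suc m) = cong₂ _+_ (cong χ₃ (+-identityʳ c))
  (trans (∑-cong m (λ j → cong χ₃ (rearrange c j))) (∑-row (2 + c) m))
  where
  rearrange : ∀ c j → c + 2 * suc j ≡ 2 + c + 2 * j
  rearrange = ℕ-Solver.solve-∀

row-periodic : ∀ c m → row (3 + c) m ≡ row c m
row-periodic c zero = refl
row-periodic c (suc m) = cong₂ _+_ (χ₃-periodic 1 c) (row-periodic (2 + c) m)

row-three : ∀ c → row c 3 ≡ 1
row-three 0 = refl
row-three 1 = refl
row-three 2 = refl
row-three (suc (suc (suc c))) = trans (row-periodic c 3) (row-three c)

row-+3 : ∀ c m → row c (3 + m) ≡ suc (row c m)
row-+3 c zero = row-three c
row-+3 c (suc m) = trans (cong (χ₃ c +_) (row-+3 (2 + c) m)) (+-suc (χ₃ c) (row (2 + c) m))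

triangle : ℕ → ℕ → ℕ
triangle c zero = row c 1
triangle c (suc h) = row c (2 + h) + triangle (1 + c) h

∑-triangle : ∀ c h → ∑ (suc h) (λ i → row (c + i) (suc (h ∸ i))) ≡ triangle c h
∑-triangle c zero = trans (+-identityʳ _) (cong (λ x → row x 1) (+-identityʳ c))
∑-triangle c (suc h) = cong₂ _+_ (cong (λ x → row x (2 + h)) (+-identityʳ c))
  (trans (∑-cong (suc h) (λ i → cong (λ x → row x (suc (h ∸ i))) (+-suc c i))) (∑-triangle (1 + c) h))

triangle-periodic : ∀ c h → triangle (3 + c) h ≡ triangle c h
triangle-periodic c zero = row-periodic c 1
triangle-periodic c (suc h) = cong₂ _+_ (row-periodic c (2 + h)) (triangle-periodic (1 + c) h)

triangle-three : ∀ c → triangle c 3 ≡ 3 + triangle c 0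
triangle-three 0 = refl
triangle-three 1 = refl
triangle-three 2 = refl
triangle-three (suc (suc (suc c))) =
  trans (triangle-periodic c 3) (trans (triangle-three c) (cong (3 +_) (sym (triangle-periodic c 0))))

triangle-+3 : ∀ c h → triangle c (3 + h) ≡ 3 + h + triangle c h
triangle-+3 c zero = triangle-three c
triangle-+3 c (suc h) = begin
  row c (3 + (2 + h)) + triangle (1 + c) (3 + h)      ≡⟨ cong₂ _+_ (row-+3 c (2 + h)) (triangle-+3 (1 + c) h) ⟩
  suc (row c (2 + h)) + (3 + h + triangle (1 + c) h)  ≡⟨ rearrange (row c (2 + h)) h (triangle (1 + c) h) ⟩
  3 + suc h + (row c (2 + h) + triangle (1 + c) h)    ∎
  where
  open ≡-Reasoning
  rearrange : ∀ r h t → suc r + (3 + h + t) ≡ 3 + suc h + (r + t)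
  rearrange = ℕ-Solver.solve-∀

𝟙-Cond : ∀ k v₁ v₂ v₃ → 𝟙 (Cond? k (v₁ , v₂ , v₃)) ≡ χ₃ (2 * k + v₁ + 2 * v₂)
𝟙-Cond k v₁ v₂ v₃ = begin
  𝟙 (Cond? k (v₁ , v₂ , v₃))           ≡⟨ 𝟙-cong (∣[n-k]⇔∣n+d*k 2 (v₁ + 2 * v₂ + 3 * v₃) k) ⟩
  χ₃ (v₁ + 2 * v₂ + 3 * v₃ + 2 * k)     ≡⟨ cong χ₃ (rearrange v₁ v₂ v₃ k) ⟩
  χ₃ (3 * v₃ + (2 * k + v₁ + 2 * v₂))   ≡⟨ χ₃-periodic v₃ (2 * k + v₁ + 2 * v₂) ⟩
  χ₃ (2 * k + v₁ + 2 * v₂)              ∎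
  where
  open ≡-Reasoning
  rearrange : ∀ v₁ v₂ v₃ k → v₁ + 2 * v₂ + 3 * v₃ + 2 * k ≡ 3 * v₃ + (2 * k + v₁ + 2 * v₂)
  rearrange = ℕ-Solver.solve-∀

card≡triangle : ∀ k h → card k h ≡ triangle (2 * k) h
card≡triangle k h = begin
  card k h
    ≡⟨ length-filter-concatMap-applyUpTo (Cond? k) column id (suc h) ⟩
  ∑ (suc h) (λ i → length (filter (Cond? k) (column i)))
    ≡⟨ ∑-cong (suc h) (λ i → length-filter-map-applyUpTo (Cond? k) (λ v₂ → (i , v₂ , h ∸ i ∸ v₂)) id (suc (h ∸ i))) ⟩
  ∑ (suc h) (λ i → ∑ (suc (h ∸ i)) (λ j → 𝟙 (Cond? k (i , j , h ∸ i ∸ j))))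
    ≡⟨ ∑-cong (suc h) (λ i → ∑-cong (suc (h ∸ i)) (λ j → 𝟙-Cond k i j (h ∸ i ∸ j))) ⟩
  ∑ (suc h) (λ i → ∑ (suc (h ∸ i)) (λ j → χ₃ (2 * k + i + 2 * j)))
    ≡⟨ ∑-cong (suc h) (λ i → ∑-row (2 * k + i) (suc (h ∸ i))) ⟩
  ∑ (suc h) (λ i → row (2 * k + i) (suc (h ∸ i)))
    ≡⟨ ∑-triangle (2 * k) h ⟩
  triangle (2 * k) h
    ∎
  where
  open ≡-Reasoning
  column : ℕ → List Triple
  column v₁ = map (λ v₂ → (v₁ , v₂ , h ∸ v₁ ∸ v₂)) (upTo (suc (h ∸ v₁)))

card-+3 : ∀ k h → card k (3 + h) ≡ 3 + h + card k h
card-+3 k h = begin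
  card k (3 + h)                ≡⟨ card≡triangle k (3 + h) ⟩
  triangle (2 * k) (3 + h)      ≡⟨ triangle-+3 (2 * k) h ⟩
  3 + h + triangle (2 * k) h    ≡⟨ cong (3 + h +_) (sym (card≡triangle k h)) ⟩
  3 + h + card k h              ∎
  where open ≡-Reasoning

card-gap-+3 : ∀ d k l h → d + card k h ≡ card l h → d + card k (3 + h) ≡ card l (3 + h)
card-gap-+3 d k l h gap = begin
  d + card k (3 + h)            ≡⟨ cong (d +_) (card-+3 k h) ⟩
  d + (3 + h + card k h)        ≡⟨ rearrange d (3 + h) (card k h) ⟩
  3 + h + (d + card k h)        ≡⟨ cong (3 + h +_) gap ⟩
  3 + h + card l h              ≡⟨ sym (card-+3 l h) ⟩
  card l (3 + h)                ∎
  where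
  open ≡-Reasoning
  rearrange : ∀ x y z → x + (y + z) ≡ y + (x + z)
  rearrange = ℕ-Solver.solve-∀

card₁≡card₂ : ∀ h → card 1 h ≡ card 2 h
card₁≡card₂ 0 = refl
card₁≡card₂ 1 = refl
card₁≡card₂ 2 = refl
card₁≡card₂ (suc (suc (suc h))) = card-gap-+3 0 1 2 h (card₁≡card₂ h)

card₂≡card₃ : ∀ h → ¬ 3 ∣ h → card 2 h ≡ card 3 h
card₂≡card₃ 0 3∤0 = ⊥-elim (3∤0 (3 ℕ∣.∣0))
card₂≡card₃ 1 _ = refl
card₂≡card₃ 2 _ = refl
card₂≡card₃ (suc (suc (suc h))) 3∤3+h =
  card-gap-+3 0 2 3 h (card₂≡card₃ h (3∤3+h ∘ Equivalence.from (∣m+n⇔∣n (ℕ∣.∣-refl {3}))))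

1+card₂≡card₃ : ∀ h → 3 ∣ h → suc (card 2 h) ≡ card 3 h
1+card₂≡card₃ 0 _ = refl
1+card₂≡card₃ 1 3∣1 = ⊥-elim (toWitnessFalse {a? = 3 ℕ∣.∣? 1} _ 3∣1)
1+card₂≡card₃ 2 3∣2 = ⊥-elim (toWitnessFalse {a? = 3 ℕ∣.∣? 2} _ 3∣2)
1+card₂≡card₃ (suc (suc (suc h))) 3∣3+h =
  card-gap-+3 1 2 3 h (1+card₂≡card₃ h (Equivalence.to (∣m+n⇔∣n (ℕ∣.∣-refl {3})) 3∣3+h))

lemma3p4 : (h : ℕ) →
    (¬ (3 ∣ h) → card 1 h ≡ card 2 h × card 2 h ≡ card 3 h) ×
    (3 ∣ h → card 1 h ≡ card 2 h × suc (card 2 h) ≡ card 3 h)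
lemma3p4 h = (λ 3∤h → card₁≡card₂ h , card₂≡card₃ h 3∤h)
           , (λ 3∣h → card₁≡card₂ h , 1+card₂≡card₃ h 3∣h)
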